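{- Let $r\ge 1$ be an integer. (i) For every finite tree $T$ with edge set $F$ and every finite multiset $\mathcal{P}$ of paths in $T$ each having at least $r$ edges, there is a colouring of $F$ with $\lceil r/2\rceil$ colours such that every path in $\mathcal{P}$ contains an edge of each colour. (ii) There exist a finite tree $T$ and a finite family $\mathcal{P}$ of paths in $T$, each with at least $r$ edges, such that for no colouring of the edges of $T$ with $\lceil r/2\rceil+1$ colours does every path in $\mathcal{P}$ contain an edge of each colour. In other words, over all hypergraphs whose vertex set is the edge set of a tree and whose hyperedges are edge sets of paths, with all hyperedges of size at least $r$, the minimum polychromatic number is exactly $\lceil r/2\rceil$.
   Context: A polychromatic $k$-colouring of a hypergraph is a map from its vertices to $k$ colours such that every hyperedge contains a vertex of every colour; the polychromatic number is the maximum $k$ for which one exists. -}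

module Defs where

open import Data.Nat using (ℕ; zero; suc; _≤_)
open import Data.Fin using (Fin; inject₁; fromℕ)
open import Data.Product using (_×_; _,_; proj₁; proj₂; ∃; Σ)
open import Data.Sum using (_⊎_)
open import Relation.Binary.PropositionalEquality using (_≡_; _≢_)
open import Relation.Nullary using (¬_)
open import Function.Definitions using (Injective)

Ends : ℕ → ℕ → Set
Ends n m = Fin m → Fin n × Fin n

Joins : ∀ {n m} → Ends n m → Fin m → Fin n → Fin n → Set
Joins ends e u v = (ends e ≡ (u , v)) ⊎ (ends e ≡ (v , u))

record Path {n m : ℕ} (ends : Ends n m) : Set where
  field
    len   : ℕ
    verts : Fin (suc len) → Fin n
    edges : Fin len → Fin m
    verts-distinct : Injective _≡_ _≡_ verts
    edges-join : ∀ i → Joins ends (edges i) (verts (inject₁ i)) (verts (Fin.suc i))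

  start : Fin n
  start = verts Fin.zero

  end : Fin n
  end = verts (fromℕ len)

open Path public

Simple : ∀ {n m} → Ends n m → Set
Simple {n} {m} ends =
  (∀ e → proj₁ (ends e) ≢ proj₂ (ends e)) ×
  (∀ (e e' : Fin m) (u v : Fin n) → Joins ends e u v → Joins ends e' u v → e ≡ e')

Connected : ∀ {n m} → Ends n m → Set
Connected {n} ends = ∀ (u v : Fin n) → Σ (Path ends) λ p → (start p ≡ u) × (end p ≡ v)

Acyclic : ∀ {n m} → Ends n m → Set
Acyclic {n} {m} ends =
  ¬ (Σ (Path ends) λ p → (2 ≤ len p) × ∃ λ (e : Fin m) → Joins ends e (end p) (start p))

IsTree : ∀ {n m} → Ends n m → Set
IsTree ends = Simple ends × Connected ends × Acyclic ends

Polychromatic : ∀ {n m k} {ends : Ends n m} → (Fin m → Fin k) → Path ends → Set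
Polychromatic {k = k} c p = ∀ (j : Fin k) → ∃ λ (i : Fin (len p)) → c (edges p i) ≡ j

module Submission where

-- (i) Root the tree at vertex 0 and colour each edge by the larger depth of its
-- endpoints, modulo K.  Along a path the depth moves by ±1 per step and has no
-- strict local maximum (a vertex has only one neighbour nearer the root), so it
-- descends and then rises.  A path with 2K - 1 edges thus has K consecutive
-- descending or K consecutive rising steps, whose colours are K consecutive
-- numbers modulo K.
--
-- (ii) In the spider with K + 2 legs of K edges, a colouring with K + 1 colours
-- misses a colour on every leg; two legs miss the same colour, and so does the
-- path with 2K edges joining their tips.

open import Defs
open import Data.Nat using (ℕ; zero; suc; _+_; _*_; _∸_; _≤_; _<_; _≤?_; _≟_; _⊔_; _%_; ⌈_/2⌉; ⌊_/2⌋; z≤n; s≤s; s≤s⁻¹; z<s)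
open import Data.Nat.Properties
open import Data.Nat.DivMod using (_mod_; m%n<n; m<n⇒m%n≡m; [m+kn]%n≡m%n; [m+n]%n≡m%n)
open import Data.Fin using (Fin; toℕ; fromℕ<) renaming (zero to fzero; suc to fsuc)
open import Data.Fin.Properties using (toℕ-injective; toℕ<n; toℕ-inject₁; toℕ-fromℕ; toℕ-fromℕ<; pigeonhole; ¬∀⟶∃¬; all?; any?) renaming (_≟_ to _≟F_; suc-injective to fsuc-injective; <⇒≢ to <⇒≢F)
open import Data.Product using (_×_; _,_; proj₁; proj₂; ∃; Σ; Σ-syntax)
open import Data.Sum using (_⊎_; inj₁; inj₂)
open import Data.Empty using (⊥; ⊥-elim)
open import Data.List using (List; []; _∷_; concat; tabulate)
open import Data.List.Relation.Unary.All as All using (All; []; _∷_)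
open import Data.List.Relation.Unary.All.Properties using (concat⁺; concat⁻; tabulate⁺; tabulate⁻)
open import Relation.Nullary using (¬_; Dec; yes; no; contradiction)
open import Relation.Binary.PropositionalEquality

-- clamp L k is k read as an element of Fin (suc L); it is exact when k ≤ L.
clamp : ∀ L → ℕ → Fin (suc L)
clamp L zero = fzero
clamp zero (suc k) = fzero
clamp (suc L) (suc k) = fsuc (clamp L k)

toℕ-clamp : ∀ L k → k ≤ L → toℕ (clamp L k) ≡ k
toℕ-clamp L zero _ = refl
toℕ-clamp (suc L) (suc k) (s≤s k≤L) = cong suc (toℕ-clamp L k k≤L)

cut : {A : Set} → ℕ → (ℕ → A) → (ℕ → A) → ℕ → A
cut i a b t with t ≤? i
... | yes _ = a t
... | no _ = b t

cut-≤ : ∀ {A : Set} {i t} (a b : ℕ → A) → t ≤ i → cut i a b t ≡ a t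
cut-≤ {i = i} {t} a b t≤i with t ≤? i
... | yes _ = refl
... | no t≰i = contradiction t≤i t≰i

cut-> : ∀ {A : Set} {i t} (a b : ℕ → A) → i < t → cut i a b t ≡ b t
cut-> {i = i} {t} a b i<t with t ≤? i
... | yes t≤i = contradiction t≤i (<⇒≱ i<t)
... | no _ = refl

∸-offset : ∀ {i j t} → i ≤ t → t < i + j → t ∸ i < j
∸-offset {i} {j} {t} i≤t t<i+j = +-cancelˡ-< i (t ∸ i) j (subst (_< i + j) (sym (m+[n∸m]≡n i≤t)) t<i+j)

module _ {P : ℕ → Set} (P? : ∀ i → Dec (P i)) where

  least : ∀ n → Σ[ i ∈ ℕ ] (i ≤ n × P i) → Σ[ i ∈ ℕ ] (i ≤ n × P i × (∀ j → j < i → ¬ P j))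
  least zero (i , i≤0 , Pi) = 0 , z≤n , subst P (n≤0⇒n≡0 i≤0) Pi , λ _ ()
  least (suc n) w with anyUpTo? P? (suc n)
  ... | yes (j , j<1+n , Pj) with least n (j , s≤s⁻¹ j<1+n , Pj)
  ...   | i , i≤n , Pi , smaller = i , m≤n⇒m≤1+n i≤n , Pi , smaller
  least (suc n) (i , i≤1+n , Pi) | no none = suc n , ≤-refl , top , λ j j<1+n Pj → none (j , j<1+n , Pj)
    where
    top : P (suc n)
    top with m≤n⇒m<n∨m≡n i≤1+n
    ... | inj₁ i<1+n = ⊥-elim (none (i , i<1+n , Pi))
    ... | inj₂ refl = Pi

argmax : (g : ℕ → ℕ) → ∀ L → Σ[ x ∈ ℕ ] (x ≤ L × (∀ t → t ≤ L → g t ≤ g x))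
argmax g zero = 0 , z≤n , λ t t≤0 → ≤-reflexive (cong g (n≤0⇒n≡0 t≤0))
argmax g (suc L) with argmax g L
... | x , x≤L , max with g (suc L) ≤? g x
...   | yes le = x , m≤n⇒m≤1+n x≤L , bound
  where
  bound : ∀ t → t ≤ suc L → g t ≤ g x
  bound t t≤1+L with m≤n⇒m<n∨m≡n t≤1+L
  ... | inj₁ t<1+L = max t (s≤s⁻¹ t<1+L)
  ... | inj₂ refl = le
...   | no gt = suc L , ≤-refl , bound
  where
  bound : ∀ t → t ≤ suc L → g t ≤ g (suc L)
  bound t t≤1+L with m≤n⇒m<n∨m≡n t≤1+L
  ... | inj₁ t<1+L = ≤-trans (max t (s≤s⁻¹ t<1+L)) (<⇒≤ (≰⇒> gt))
  ... | inj₂ refl = ≤-refl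

-- Paths in a graph, presented as vertex sequences t ↦ at t indexed by ℕ
-- (only t ≤ size matters); arithmetic on ℕ indices is far easier than on Fin.
module IndexedPaths {n m : ℕ} (ends : Ends n m) where

  Adj : Fin n → Fin n → Set
  Adj u v = Σ (Fin m) λ e → Joins ends e u v

  joins-sym : ∀ {e u v} → Joins ends e u v → Joins ends e v u
  joins-sym (inj₁ eq) = inj₂ eq
  joins-sym (inj₂ eq) = inj₁ eq

  -- Both operations keep the edge definitionally, so edges can be tracked.
  adj-sym : ∀ {u v} → Adj u v → Adj v u
  adj-sym a = proj₁ a , joins-sym (proj₂ a)

  adj-cong : ∀ {u u' v v'} → u ≡ u' → v ≡ v' → Adj u v → Adj u' v'
  adj-cong u≡u' v≡v' a = proj₁ a , subst₂ (Joins ends (proj₁ a)) u≡u' v≡v' (proj₂ a)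

  adj-distinct : (∀ e → proj₁ (ends e) ≢ proj₂ (ends e)) → ∀ {u v} → Adj u v → u ≢ v
  adj-distinct loopless (e , inj₁ eq) u≡v = loopless e (trans (cong proj₁ eq) (trans u≡v (sym (cong proj₂ eq))))
  adj-distinct loopless (e , inj₂ eq) u≡v = loopless e (trans (cong proj₁ eq) (trans (sym u≡v) (sym (cong proj₂ eq))))

  record ℕPath : Set where
    field
      size : ℕ
      at : ℕ → Fin n
      at-inj : ∀ {i j} → i ≤ size → j ≤ size → at i ≡ at j → i ≡ j
      step : ∀ i → i < size → Adj (at i) (at (suc i))
  open ℕPath public

  last : ℕPath → Fin n
  last p = at p (size p)

  edge : (p : ℕPath) → ∀ t → t < size p → Fin m
  edge p t t<size = proj₁ (step p t t<size)

  EdgeOf : ℕPath → Fin m → Set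
  EdgeOf p e = Σ[ t ∈ ℕ ] Σ[ t<size ∈ t < size p ] edge p t t<size ≡ e

  toPath : ℕPath → Path ends
  toPath p = record
    { len = size p
    ; verts = λ i → at p (toℕ i)
    ; edges = λ i → edge p (toℕ i) (toℕ<n i)
    ; verts-distinct = λ {i} {j} eq → toℕ-injective (at-inj p (s≤s⁻¹ (toℕ<n i)) (s≤s⁻¹ (toℕ<n j)) eq)
    ; edges-join = λ i → subst (λ x → Joins ends (edge p (toℕ i) (toℕ<n i)) (at p x) (at p (suc (toℕ i))))
                           (sym (toℕ-inject₁ i)) (proj₂ (step p (toℕ i) (toℕ<n i)))
    }

  toPath-end : ∀ p → end (toPath p) ≡ last p
  toPath-end p = cong (at p) (toℕ-fromℕ (size p))

  toPath-edges : ∀ p (i : Fin (size p)) → EdgeOf p (edges (toPath p) i)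
  toPath-edges p i = toℕ i , toℕ<n i , refl

  fromPath : Path ends → ℕPath
  fromPath p = record
    { size = len p
    ; at = λ t → verts p (clamp (len p) t)
    ; at-inj = λ {i} {j} i≤ j≤ eq → trans (sym (toℕ-clamp _ i i≤)) (trans (cong toℕ (verts-distinct p eq)) (toℕ-clamp _ j j≤))
    ; step = λ t t<len → edges p (fromℕ< t<len) ,
               subst₂ (Joins ends (edges p (fromℕ< t<len)))
                 (cong (verts p) (toℕ-injective (trans (toℕ-inject₁ _) (trans (toℕ-fromℕ< t<len) (sym (toℕ-clamp _ t (<⇒≤ t<len)))))))
                 (cong (verts p) (toℕ-injective (trans (cong suc (toℕ-fromℕ< t<len)) (sym (toℕ-clamp _ (suc t) t<len)))))
                 (edges-join p (fromℕ< t<len))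
    }

  fromPath-end : ∀ p → last (fromPath p) ≡ end p
  fromPath-end p = cong (verts p) (toℕ-injective (trans (toℕ-clamp _ _ ≤-refl) (sym (toℕ-fromℕ (len p)))))

  prefix : (p : ℕPath) → ∀ j → j ≤ size p → ℕPath
  prefix p j j≤size = record
    { size = j
    ; at = at p
    ; at-inj = λ i≤j i'≤j → at-inj p (≤-trans i≤j j≤size) (≤-trans i'≤j j≤size)
    ; step = λ i i<j → step p i (<-≤-trans i<j j≤size)
    }

  tail : (p : ℕPath) → 1 ≤ size p → ℕPath
  tail p 1≤size = record
    { size = size p ∸ 1
    ; at = λ i → at p (suc i)
    ; at-inj = λ i≤ j≤ eq → suc-injective (at-inj p (inner i≤) (inner j≤) eq)
    ; step = λ i i< → step p (suc i) (inner i<)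
    }
    where
    inner : ∀ {i} → i ≤ size p ∸ 1 → suc i ≤ size p
    inner i≤ = subst (suc _ ≤_) (m+[n∸m]≡n 1≤size) (s≤s i≤)

  tail-last : ∀ p (1≤size : 1 ≤ size p) → last (tail p 1≤size) ≡ last p
  tail-last p 1≤size = cong (at p) (m+[n∸m]≡n 1≤size)

  reverse : ℕPath → ℕPath
  reverse p = record
    { size = size p
    ; at = λ t → at p (size p ∸ t)
    ; at-inj = λ {i} {j} i≤ j≤ eq → ∸-cancelˡ-≡ i≤ j≤ (at-inj p (m∸n≤m (size p) i) (m∸n≤m (size p) j) eq)
    ; step = λ t t<size → adj-cong (cong (at p) (sym (+-∸-assoc 1 t<size))) refl
                            (adj-sym (step p (size p ∸ suc t) (∸-monoʳ-< z<s t<size)))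
    }

  reverse-edges : ∀ p {e} → EdgeOf (reverse p) e → EdgeOf p e
  reverse-edges p (t , t<size , eq) = size p ∸ suc t , ∸-monoʳ-< z<s t<size , eq

  module Glue (p q : ℕPath) (joint : last p ≡ at q 0)
              (apart : ∀ {i j} → i ≤ size p → j ≤ size q → at p i ≡ at q j → i ≡ size p) where

    G : ℕ → Fin n
    G = cut (size p) (at p) (λ t → at q (t ∸ size p))

    G-left : ∀ {t} → t ≤ size p → G t ≡ at p t
    G-left = cut-≤ _ _

    G-right : ∀ {t} → size p ≤ t → G t ≡ at q (t ∸ size p)
    G-right {t} sp≤t with m≤n⇒m<n∨m≡n sp≤t
    ... | inj₁ sp<t = cut-> _ _ sp<t
    ... | inj₂ refl = trans (G-left ≤-refl) (trans joint (cong (at q) (sym (n∸n≡0 (size p)))))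

    right-index : ∀ {t} → t ≤ size p + size q → t ∸ size p ≤ size q
    right-index {t} t≤ = subst (t ∸ size p ≤_) (m+n∸m≡n (size p) (size q)) (∸-monoˡ-≤ (size p) t≤)

    crossing : ∀ {i j} → i ≤ size p → size p < j → j ≤ size p + size q → G i ≢ G j
    crossing {i} {j} i≤ sp<j j≤ eq = <⇒≱ sp<j (m∸n≡0⇒m≤n (sym (at-inj q z≤n (right-index j≤) q0≡qj)))
      where
      pi≡qj : at p i ≡ at q (j ∸ size p)
      pi≡qj = trans (sym (G-left i≤)) (trans eq (G-right (<⇒≤ sp<j)))
      q0≡qj : at q 0 ≡ at q (j ∸ size p)
      q0≡qj = trans (sym joint) (trans (cong (at p) (sym (apart i≤ (right-index j≤) pi≡qj))) pi≡qj)

    G-inj : ∀ {i j} → i ≤ size p + size q → j ≤ size p + size q → G i ≡ G j → i ≡ j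
    G-inj {i} {j} i≤ j≤ eq = by-sides (i ≤? size p) (j ≤? size p)
      where
      offsets : size p ≤ i → size p ≤ j → i ∸ size p ≡ j ∸ size p
      offsets sp≤i sp≤j = at-inj q (right-index i≤) (right-index j≤) (trans (sym (G-right sp≤i)) (trans eq (G-right sp≤j)))

      by-sides : Dec (i ≤ size p) → Dec (j ≤ size p) → i ≡ j
      by-sides (yes i≤sp) (yes j≤sp) = at-inj p i≤sp j≤sp (trans (sym (G-left i≤sp)) (trans eq (G-left j≤sp)))
      by-sides (yes i≤sp) (no j≰sp) = ⊥-elim (crossing i≤sp (≰⇒> j≰sp) j≤ eq)
      by-sides (no i≰sp) (yes j≤sp) = ⊥-elim (crossing j≤sp (≰⇒> i≰sp) i≤ (sym eq))
      by-sides (no i≰sp) (no j≰sp) = begin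
        i                     ≡⟨ m+[n∸m]≡n sp≤i ⟨
        size p + (i ∸ size p) ≡⟨ cong (size p +_) (offsets sp≤i sp≤j) ⟩
        size p + (j ∸ size p) ≡⟨ m+[n∸m]≡n sp≤j ⟩
        j                     ∎
        where
        open ≡-Reasoning
        sp≤i : size p ≤ i
        sp≤i = <⇒≤ (≰⇒> i≰sp)
        sp≤j : size p ≤ j
        sp≤j = <⇒≤ (≰⇒> j≰sp)

    G-step : ∀ t → t < size p + size q → Dec (suc t ≤ size p) → Adj (G t) (G (suc t))
    G-step t _ (yes t<sp) = adj-cong (sym (G-left (<⇒≤ t<sp))) (sym (G-left t<sp)) (step p t t<sp)
    G-step t t< (no t≮sp) = adj-cong (sym (G-right sp≤t)) (sym (trans (G-right (m≤n⇒m≤1+n sp≤t)) (cong (at q) (+-∸-assoc 1 sp≤t))))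
                              (step q (t ∸ size p) (∸-offset sp≤t t<))
      where
      sp≤t : size p ≤ t
      sp≤t = s≤s⁻¹ (≰⇒> t≮sp)

    glued : ℕPath
    glued = record { size = size p + size q ; at = G ; at-inj = G-inj ; step = λ t t< → G-step t t< (suc t ≤? size p) }

    glued-edges : ∀ {e} → EdgeOf glued e → EdgeOf p e ⊎ EdgeOf q e
    glued-edges (t , t< , eq) = by-side (suc t ≤? size p) eq
      where
      by-side : ∀ {e} (d : Dec (suc t ≤ size p)) → proj₁ (G-step t t< d) ≡ e → EdgeOf p e ⊎ EdgeOf q e
      by-side (yes t<sp) eq = inj₁ (t , t<sp , eq)
      by-side (no t≮sp) eq = inj₂ (t ∸ size p , ∸-offset (s≤s⁻¹ (≰⇒> t≮sp)) t< , eq)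

  two-point : Fin n → Fin n → ℕ → Fin n
  two-point u v zero = u
  two-point u v (suc _) = v

  single : ∀ {u v} → Adj u v → u ≢ v → ℕPath
  single {u} {v} a u≢v = record { size = 1 ; at = two-point u v ; at-inj = inj ; step = one-step }
    where
    inj : ∀ {i j} → i ≤ 1 → j ≤ 1 → two-point u v i ≡ two-point u v j → i ≡ j
    inj {zero} {zero} _ _ _ = refl
    inj {zero} {suc _} _ _ eq = ⊥-elim (u≢v eq)
    inj {suc _} {zero} _ _ eq = ⊥-elim (u≢v (sym eq))
    inj {suc i} {suc j} (s≤s i≤0) (s≤s j≤0) _ = cong suc (trans (n≤0⇒n≡0 i≤0) (sym (n≤0⇒n≡0 j≤0)))
    one-step : ∀ i → i < 1 → Adj (two-point u v i) (two-point u v (suc i))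
    one-step zero _ = a
    one-step (suc i) (s≤s ())

  module Extend (p : ℕPath) {v : Fin n} (a : Adj (last p) v) (fresh : ∀ j → j ≤ size p → at p j ≢ v) where

    apart : ∀ {i j} → i ≤ size p → j ≤ 1 → at p i ≡ two-point (last p) v j → i ≡ size p
    apart {i} {zero} i≤ _ eq = at-inj p i≤ ≤-refl eq
    apart {i} {suc _} i≤ _ eq = ⊥-elim (fresh i i≤ eq)

    open Glue p (single a (fresh (size p) ≤-refl)) refl apart

    extended : ℕPath
    extended = glued

    extended-≤ : ∀ {t} → t ≤ size p → at extended t ≡ at p t
    extended-≤ = G-left

    extended-last : last extended ≡ v
    extended-last = trans (G-right (m≤m+n (size p) 1)) (cong (two-point (last p) v) (m+n∸m≡n (size p) 1))

  open Extend using (extended; extended-≤; extended-last) public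

  -- Two paths with a common last vertex contain a path between their first
  -- vertices: follow p up to its first vertex lying on q, then q backwards.
  module Join (p q : ℕPath) (common : last p ≡ last q) where

    OnQ : ℕ → Set
    OnQ i = ∃ λ j → j < suc (size q) × at p i ≡ at q j

    meeting : Σ[ i ∈ ℕ ] (i ≤ size p × OnQ i × (∀ i' → i' < i → ¬ OnQ i'))
    meeting = least (λ i → anyUpTo? (λ j → at p i ≟F at q j) (suc (size q))) (size p)
                (size p , ≤-refl , size q , ≤-refl , common)

    i : ℕ
    i = proj₁ meeting

    j : ℕ
    j = proj₁ (proj₁ (proj₂ (proj₂ meeting)))

    i≤ : i ≤ size p
    i≤ = proj₁ (proj₂ meeting)

    j≤ : j ≤ size q
    j≤ = s≤s⁻¹ (proj₁ (proj₂ (proj₁ (proj₂ (proj₂ meeting)))))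

    meets : at p i ≡ at q j
    meets = proj₂ (proj₂ (proj₁ (proj₂ (proj₂ meeting))))

    apart : ∀ {a b} → a ≤ i → b ≤ j → at p a ≡ at q (j ∸ b) → a ≡ i
    apart {a} {b} a≤i b≤j eq with m≤n⇒m<n∨m≡n a≤i
    ... | inj₁ a<i = ⊥-elim (proj₂ (proj₂ (proj₂ meeting)) a a<i (j ∸ b , s≤s (≤-trans (m∸n≤m j b) j≤) , eq))
    ... | inj₂ a≡i = a≡i

    open Glue (prefix p i i≤) (reverse (prefix q j j≤)) meets apart

    joined : ℕPath
    joined = glued

    joined-first : at joined 0 ≡ at p 0
    joined-first = G-left z≤n

    joined-last : last joined ≡ at q 0
    joined-last = begin
      last joined            ≡⟨ G-right (m≤m+n i j) ⟩
      at q (j ∸ (i + j ∸ i)) ≡⟨ cong (λ x → at q (j ∸ x)) (m+n∸m≡n i j) ⟩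
      at q (j ∸ j)           ≡⟨ cong (at q) (n∸n≡0 j) ⟩
      at q 0                 ∎
      where open ≡-Reasoning

  Neighbours : ℕPath → ℕ → Set
  Neighbours p x = Σ[ y ∈ ℕ ] Σ[ y' ∈ ℕ ]
    (y ≢ y' × y ≤ size p × y' ≤ size p × Adj (at p x) (at p y) × Adj (at p x) (at p y'))

  cycle-neighbours : ∀ p → 2 ≤ size p → Adj (last p) (at p 0) → ∀ x → x ≤ size p → Neighbours p x
  cycle-neighbours p 2≤ closing zero _ =
    size p , 1 , (λ eq → <⇒≱ 2≤ (≤-reflexive eq)) , ≤-refl , ≤-trans (n≤1+n 1) 2≤ , adj-sym closing , step p 0 (≤-trans (n≤1+n 1) 2≤)
  cycle-neighbours p 2≤ closing (suc x) x< with suc x ≟ size p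
  ... | yes x-last = x , 0 , x≢0 , ≤-trans (n≤1+n x) x< , z≤n ,
                     adj-sym (step p x x<) , adj-cong (cong (at p) (sym x-last)) refl closing
    where
    x≢0 : x ≢ 0
    x≢0 refl = <⇒≱ 2≤ (≤-reflexive (sym x-last))
  ... | no x-inner = x , suc (suc x) , x≢2+x , ≤-trans (n≤1+n x) x< , ≤∧≢⇒< x< x-inner ,
                     adj-sym (step p x x<) , step p (suc x) (≤∧≢⇒< x< x-inner)
    where
    x≢2+x : ∀ {y} → y ≢ suc (suc y)
    x≢2+x ()

  module Unique (acyclic : Acyclic ends) where

    -- Paths with the same ends leave the first vertex along the same edge;
    -- otherwise the rest of p, the start of q and p's first edge form a cycle.
    same-second : ∀ p q → at p 0 ≡ at q 0 → last p ≡ last q → (1≤p : 1 ≤ size p) → 1 ≤ size q → at p 1 ≡ at q 1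
    same-second p q e0 eL 1≤p 1≤q with at p 1 ≟F at q 1
    ... | yes e1 = e1
    ... | no e1 = ⊥-elim (acyclic (toPath joined , long i j i≤ meets , proj₁ closing , proj₂ closing))
      where
      open Join (tail p 1≤p) q (trans (tail-last p 1≤p) eL)
      closing : Adj (end (toPath joined)) (start (toPath joined))
      closing = adj-cong (trans e0 (sym (trans (toPath-end joined) joined-last))) (sym joined-first) (step p 0 1≤p)
      long : ∀ a b → a ≤ size p ∸ 1 → at p (suc a) ≡ at q b → 2 ≤ a + b
      long 0 0 _ eq = ⊥-elim (1+n≢0 (at-inj p 1≤p z≤n (trans eq (sym e0))))
      long 0 1 _ eq = ⊥-elim (e1 eq)
      long 0 (suc (suc b)) _ _ = s≤s (s≤s z≤n)
      long 1 0 a≤ eq = ⊥-elim (1+n≢0 (at-inj p (subst (2 ≤_) (m+[n∸m]≡n 1≤p) (s≤s a≤)) z≤n (trans eq (sym e0))))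
      long 1 (suc b) _ _ = s≤s (s≤s z≤n)
      long (suc (suc a)) b _ _ = s≤s (s≤s z≤n)

    Agree : ℕPath → ℕPath → Set
    Agree p q = (size p ≡ size q) × (∀ t → t ≤ size p → at p t ≡ at q t)

    unique : ∀ p q → at p 0 ≡ at q 0 → last p ≡ last q → Agree p q
    unique p q = by-size (size p) p q refl
      where
      by-size : ∀ k p q → size p ≡ k → at p 0 ≡ at q 0 → last p ≡ last q → Agree p q
      by-size zero p q sp≡0 e0 eL = sp≡sq , agree
        where
        sp≡sq : size p ≡ size q
        sp≡sq = trans sp≡0 (at-inj q z≤n ≤-refl (trans (sym e0) (trans (cong (at p) (sym sp≡0)) eL)))
        agree : ∀ t → t ≤ size p → at p t ≡ at q t
        agree t t≤ rewrite n≤0⇒n≡0 (subst (t ≤_) sp≡0 t≤) = e0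
      by-size (suc k) p q sp≡ e0 eL = sp≡sq , agree
        where
        1≤p : 1 ≤ size p
        1≤p = subst (1 ≤_) (sym sp≡) (s≤s z≤n)
        1≤q : 1 ≤ size q
        1≤q = n≢0⇒n>0 λ sq≡0 → 1+n≢0 (trans (sym sp≡) (at-inj p ≤-refl z≤n (trans eL (trans (cong (at q) sq≡0) (sym e0)))))
        rest : Agree (tail p 1≤p) (tail q 1≤q)
        rest = by-size k (tail p 1≤p) (tail q 1≤q) (cong (_∸ 1) sp≡) (same-second p q e0 eL 1≤p 1≤q)
                 (trans (tail-last p 1≤p) (trans eL (sym (tail-last q 1≤q))))
        sp≡sq : size p ≡ size q
        sp≡sq = trans (sym (m+[n∸m]≡n 1≤p)) (trans (cong suc (proj₁ rest)) (m+[n∸m]≡n 1≤q))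
        agree : ∀ t → t ≤ size p → at p t ≡ at q t
        agree zero _ = e0
        agree (suc t) t< = proj₂ rest t (∸-monoˡ-≤ 1 t<)

module Depth {n m : ℕ} (ends : Ends (suc n) m) (tree : IsTree ends) where
  open IndexedPaths ends
  open Unique (proj₂ (proj₂ tree))

  connected : Connected ends
  connected = proj₁ (proj₂ tree)

  route : Fin (suc n) → ℕPath
  route v = fromPath (proj₁ (connected fzero v))

  route-first : ∀ v → at (route v) 0 ≡ fzero
  route-first v = proj₁ (proj₂ (connected fzero v))

  route-last : ∀ v → last (route v) ≡ v
  route-last v = trans (fromPath-end (proj₁ (connected fzero v))) (proj₂ (proj₂ (connected fzero v)))

  depth : Fin (suc n) → ℕ
  depth v = size (route v)

  RootPath : Fin (suc n) → ℕPath → Set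
  RootPath v p = at p 0 ≡ fzero × last p ≡ v

  is-route : ∀ {v} p → RootPath v p → Agree p (route v)
  is-route {v} p (first , lst) = unique p (route v) (trans first (sym (route-first v))) (trans lst (sym (route-last v)))

  no-loop : ∀ {u v} → Adj u v → u ≢ v
  no-loop = adj-distinct (proj₁ (proj₁ tree))

  module Deeper {u v : Fin (suc n)} (p : ℕPath) (root : RootPath u p) (a : Adj u v)
                (fresh : ∀ j → j ≤ size p → at p j ≢ v) where

    a' : Adj (last p) v
    a' = adj-cong (sym (proj₂ root)) refl a

    agree : Agree (extended p a' fresh) (route v)
    agree = is-route (extended p a' fresh) (trans (extended-≤ p a' fresh z≤n) (proj₁ root) , extended-last p a' fresh)

    deeper : depth v ≡ suc (size p)
    deeper = trans (sym (proj₁ agree)) (+-comm (size p) 1)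

  open Deeper using (deeper)

  depth-step : ∀ {u v} → Adj u v → depth v ≡ suc (depth u) ⊎ depth u ≡ suc (depth v)
  depth-step {u} {v} a with anyUpTo? (λ j → at (route u) j ≟F v) (suc (depth u))
  ... | no off = inj₁ (deeper (route u) (route-first u , route-last u) a λ j j≤ eq → off (j , s≤s j≤ , eq))
  ... | yes (j , j<1+d , on) = inj₂ (trans (deeper before (route-first u , on) (adj-sym a) u-fresh) (cong suc depth-v))
    where
    j<d : j < depth u
    j<d = ≤∧≢⇒< (s≤s⁻¹ j<1+d) λ j≡d → no-loop a (trans (sym (route-last u)) (trans (cong (at (route u)) (sym j≡d)) on))
    before : ℕPath
    before = prefix (route u) j (<⇒≤ j<d)
    depth-v : j ≡ depth v
    depth-v = proj₁ (is-route before (route-first u , on))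
    u-fresh : ∀ t → t ≤ j → at (route u) t ≢ u
    u-fresh t t≤j eq = <⇒≢ (≤-<-trans t≤j j<d) (at-inj (route u) (≤-trans t≤j (<⇒≤ j<d)) ≤-refl (trans eq (sym (route-last u))))

  below : ∀ {u w} → Adj u w → depth w ≡ suc (depth u) → at (route w) (depth u) ≡ u
  below {u} {w} a dw = begin
    at (route w) (depth u)                     ≡⟨ proj₂ agree (depth u) (m≤m+n (depth u) 1) ⟨
    at (extended (route u) a' fresh) (depth u) ≡⟨ extended-≤ (route u) a' fresh ≤-refl ⟩
    last (route u)                             ≡⟨ route-last u ⟩
    u                                          ∎
    where
    open ≡-Reasoning
    fresh : ∀ j → j ≤ depth u → at (route u) j ≢ w
    fresh j j≤ eq = <⇒≢ (s≤s j≤) (trans (proj₁ (is-route (prefix (route u) j j≤) (route-first u , eq))) dw)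
    open Deeper (route u) (route-first u , route-last u) a fresh using (a'; agree)

  one-parent : ∀ {u u' w} → Adj u w → Adj u' w → depth w ≡ suc (depth u) → depth w ≡ suc (depth u') → u ≡ u'
  one-parent {w = w} a a' dw dw' =
    trans (sym (below a dw)) (trans (cong (at (route w)) (suc-injective (trans (sym dw) dw'))) (below a' dw'))

every-residue : ∀ k x j → j < suc k → Σ[ s ∈ ℕ ] (s < suc k × (x + s) % suc k ≡ j)
every-residue k zero j j<K = j , j<K , m<n⇒m%n≡m j<K
every-residue k (suc x) j j<K with every-residue k x j j<K
... | suc s , s<K , eq = s , <-trans (n<1+n s) s<K , trans (cong (_% suc k) (sym (+-suc x s))) eq
... | zero , _ , eq = k , ≤-refl , (begin
  (suc x + k) % suc k ≡⟨ cong (_% suc k) (+-suc x k) ⟨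
  (x + suc k) % suc k ≡⟨ [m+n]%n≡m%n x (suc k) ⟩
  x % suc k           ≡⟨ cong (_% suc k) (sym (+-identityʳ x)) ⟩
  (x + 0) % suc k     ≡⟨ eq ⟩
  j                   ∎)
  where open ≡-Reasoning

-- A sequence H that moves by ±1 and has no strict local maximum ("valley
-- shaped"), followed for L ≥ 2k + 1 steps: the step maxima H t ⊔ H (t + 1)
-- take every residue modulo k + 1.  Either one of the first k + 1 steps rises,
-- and then steps k, …, 2k all rise, or the first k + 1 steps all descend.
module Valley (k L : ℕ) (H : ℕ → ℕ) (long : suc (k + k) ≤ L)
  (unit-step : ∀ t → t < L → H (suc t) ≡ suc (H t) ⊎ H t ≡ suc (H (suc t)))
  (no-peak : ∀ t → suc t < L → H (suc t) ≡ suc (H t) → H (suc t) ≡ suc (H (suc (suc t))) → ⊥) where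

  Up : ℕ → Set
  Up t = H (suc t) ≡ suc (H t)

  Down : ℕ → Set
  Down t = H t ≡ suc (H (suc t))

  -- once the sequence rises it keeps rising, as a fall would create a peak
  keeps-rising : ∀ {t0} → Up t0 → ∀ d → t0 + d < L → Up (t0 + d)
  keeps-rising {t0} up0 zero _ = subst Up (sym (+-identityʳ t0)) up0
  keeps-rising {t0} up0 (suc d) t< with unit-step (t0 + suc d) t<
  ... | inj₁ up = up
  ... | inj₂ down = ⊥-elim (no-peak (t0 + d) (subst (_< L) (+-suc t0 d) t<)
                      (keeps-rising up0 d (<-trans (+-monoʳ-< t0 (n<1+n d)) t<))
                      (subst Down (+-suc t0 d) down))

  rising-after : ∀ {t0 t} → Up t0 → t0 ≤ t → t < L → Up t
  rising-after up0 t0≤t t<L =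
    subst Up (m+[n∸m]≡n t0≤t) (keeps-rising up0 _ (subst (_< L) (sym (m+[n∸m]≡n t0≤t)) t<L))

  climb : ∀ a s → (∀ d → d < s → Up (a + d)) → H (a + s) ≡ H a + s
  climb a zero _ = trans (cong H (+-identityʳ a)) (sym (+-identityʳ (H a)))
  climb a (suc s) ups = begin
    H (a + suc s)     ≡⟨ cong H (+-suc a s) ⟩
    H (suc (a + s))   ≡⟨ ups s ≤-refl ⟩
    suc (H (a + s))   ≡⟨ cong suc (climb a s λ d d<s → ups d (m<n⇒m<1+n d<s)) ⟩
    suc (H a + s)     ≡⟨ +-suc (H a) s ⟨
    H a + suc s       ∎
    where open ≡-Reasoning

  descend : ∀ a s → (∀ d → d < s → Down (a + d)) → H a ≡ H (a + s) + s
  descend a zero _ = trans (cong H (sym (+-identityʳ a))) (sym (+-identityʳ _))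
  descend a (suc s) downs = begin
    H a                       ≡⟨ descend a s (λ d d<s → downs d (m<n⇒m<1+n d<s)) ⟩
    H (a + s) + s             ≡⟨ cong (_+ s) (downs s ≤-refl) ⟩
    suc (H (suc (a + s))) + s ≡⟨ +-suc (H (suc (a + s))) s ⟨
    H (suc (a + s)) + suc s   ≡⟨ cong (λ x → H x + suc s) (+-suc a s) ⟨
    H (a + suc s) + suc s     ∎
    where open ≡-Reasoning

  rising-values : ∀ {t0} → t0 ≤ k → Up t0 → ∀ s → s ≤ k →
                  k + s < L × H (k + s) ⊔ H (suc (k + s)) ≡ suc (H k) + s
  rising-values t0≤k up0 s s≤k = k+s<L , (begin
    H (k + s) ⊔ H (suc (k + s)) ≡⟨ m≤n⇒m⊔n≡n (≤-trans (n≤1+n _) (≤-reflexive (sym (up s ≤-refl)))) ⟩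
    H (suc (k + s))             ≡⟨ up s ≤-refl ⟩
    suc (H (k + s))             ≡⟨ cong suc (climb k s λ d d<s → up d (<⇒≤ d<s)) ⟩
    suc (H k) + s               ∎)
    where
    open ≡-Reasoning
    k+s<L : k + s < L
    k+s<L = <-≤-trans (s≤s (+-monoʳ-≤ k s≤k)) long
    up : ∀ d → d ≤ s → Up (k + d)
    up d d≤s = rising-after up0 (≤-trans t0≤k (m≤m+n k d)) (≤-<-trans (+-monoʳ-≤ k d≤s) k+s<L)

  falling-values : (∀ t → t ≤ k → Down t) → ∀ s → s ≤ k →
                   k ∸ s < L × H (k ∸ s) ⊔ H (suc (k ∸ s)) ≡ H k + s
  falling-values down s s≤k = ≤-<-trans (m∸n≤m k s) (<-≤-trans (s≤s (m≤m+n k k)) long) , (begin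
    H (k ∸ s) ⊔ H (suc (k ∸ s)) ≡⟨ m≥n⇒m⊔n≡m (≤-trans (n≤1+n _) (≤-reflexive (sym (down (k ∸ s) (m∸n≤m k s))))) ⟩
    H (k ∸ s)                   ≡⟨ descend (k ∸ s) s (λ d d<s → down (k ∸ s + d) (≤-trans (+-monoʳ-≤ (k ∸ s) (<⇒≤ d<s)) (≤-reflexive (m∸n+n≡m s≤k)))) ⟩
    H (k ∸ s + s) + s           ≡⟨ cong (λ x → H x + s) (m∸n+n≡m s≤k) ⟩
    H k + s                     ∎)
    where open ≡-Reasoning

  all-falling : ¬ (∃ λ t → t < suc k × Up t) → ∀ t → t ≤ k → Down t
  all-falling none t t≤k with unit-step t (<-≤-trans (s≤s t≤k) (≤-trans (s≤s (m≤m+n k k)) long))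
  ... | inj₁ up = ⊥-elim (none (t , s≤s t≤k , up))
  ... | inj₂ down = down

  covers : ∀ j → j < suc k → Σ[ t ∈ ℕ ] (t < L × (H t ⊔ H (suc t)) % suc k ≡ j)
  covers j j<K with anyUpTo? (λ t → H (suc t) ≟ suc (H t)) (suc k)
  ... | yes (t0 , t0<K , up0) with every-residue k (suc (H k)) j j<K
  ...   | s , s<K , hit with rising-values (s≤s⁻¹ t0<K) up0 s (s≤s⁻¹ s<K)
  ...     | bound , value = k + s , bound , trans (cong (_% suc k) value) hit
  covers j j<K | no none with every-residue k (H k) j j<K
  ...   | s , s<K , hit with falling-values (all-falling none) s (s≤s⁻¹ s<K)
  ...     | bound , value = k ∸ s , bound , trans (cong (_% suc k) value) hit

module DepthColouring (k : ℕ) {n m : ℕ} (ends : Ends (suc n) m) (tree : IsTree ends) where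
  open IndexedPaths ends
  open Depth ends tree

  level : Fin m → ℕ
  level e = depth (proj₁ (ends e)) ⊔ depth (proj₂ (ends e))

  colour : Fin m → Fin (suc k)
  colour e = level e mod suc k

  level-joins : ∀ {e u v} → Joins ends e u v → level e ≡ depth u ⊔ depth v
  level-joins (inj₁ eq) = cong (λ x → depth (proj₁ x) ⊔ depth (proj₂ x)) eq
  level-joins {u = u} {v} (inj₂ eq) = trans (cong (λ x → depth (proj₁ x) ⊔ depth (proj₂ x)) eq) (⊔-comm (depth v) (depth u))

  heights : Path ends → ℕ → ℕ
  heights p t = depth (at (fromPath p) t)

  no-peak : ∀ p t → suc t < len p → heights p (suc t) ≡ suc (heights p t) →
            heights p (suc t) ≡ suc (heights p (suc (suc t))) → ⊥
  no-peak p t t< up down = t≢2+t (at-inj (fromPath p) (≤-trans (n≤1+n t) (<⇒≤ t<)) t<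
    (one-parent (step (fromPath p) t (<-trans (n<1+n t) t<)) (adj-sym (step (fromPath p) (suc t) t<)) up down))
    where
    t≢2+t : ∀ {x} → x ≢ suc (suc x)
    t≢2+t ()

  -- the depths along p form a valley-shaped sequence, so all colours occur
  polychromatic : ∀ p → suc (k + k) ≤ len p → Polychromatic colour p
  polychromatic p long j
    with Valley.covers k (len p) (heights p) long (λ t t< → depth-step (step (fromPath p) t t<)) (no-peak p) (toℕ j) (toℕ<n j)
  ... | t , t<L , hit = fromℕ< t<L , toℕ-injective (begin
    toℕ (colour (edges p (fromℕ< t<L)))  ≡⟨ toℕ-fromℕ< (m%n<n (level (edges p (fromℕ< t<L))) (suc k)) ⟩
    level (edges p (fromℕ< t<L)) % suc k ≡⟨ cong (_% suc k) (level-joins (proj₂ (step (fromPath p) t t<L))) ⟩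
    (heights p t ⊔ heights p (suc t)) % suc k ≡⟨ hit ⟩
    toℕ j                                ∎)
    where open ≡-Reasoning

colouring : ∀ k {n m} (ends : Ends (suc n) m) → IsTree ends → ∀ {r} → suc (k + k) ≤ r → (P : List (Path ends)) →
  All (λ p → r ≤ len p) P → ∃ λ (c : Fin m → Fin (suc k)) → All (Polychromatic c) P
colouring k ends tree 2k+1≤r P long = colour , All.map (λ {p} r≤len → polychromatic p (≤-trans 2k+1≤r r≤len)) long
  where open DepthColouring k ends tree

not-onto : ∀ {k} (f : Fin k → Fin (suc k)) → Σ[ j ∈ Fin (suc k) ] (∀ s → f s ≢ j)
not-onto {k} f with all? (λ j → any? (λ s → f s ≟F j))
... | no not-all with ¬∀⟶∃¬ (suc k) _ (λ j → any? (λ s → f s ≟F j)) not-all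
...   | j , unhit = j , λ s eq → unhit (s , eq)
not-onto {k} f | yes onto with pigeonhole (≤-refl {suc k}) (λ j → proj₁ (onto j))
... | i , j , i<j , same = ⊥-elim (<⇒≢F i<j (trans (sym (proj₂ (onto i))) (trans (cong f same) (proj₂ (onto j)))))

-- Trees given by a parent array: on the vertices 0, …, M, edge e joins the
-- vertex e + 1 to a smaller vertex par e.
module ParentTree {M : ℕ} (par : Fin M → Fin (suc M)) (par-below : ∀ e → toℕ (par e) ≤ toℕ e) where

  ends : Ends (suc M) M
  ends e = fsuc e , par e

  open IndexedPaths ends

  crossed : ∀ e e' → fsuc e ≡ par e' → fsuc e' ≡ par e → ⊥
  crossed e e' x y = <-irrefl refl (begin-strict
    toℕ e          <⟨ n<1+n (toℕ e) ⟩
    toℕ (fsuc e)   ≡⟨ cong toℕ x ⟩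
    toℕ (par e')   ≤⟨ par-below e' ⟩
    toℕ e'         <⟨ n<1+n (toℕ e') ⟩
    toℕ (fsuc e')  ≡⟨ cong toℕ y ⟩
    toℕ (par e)    ≤⟨ par-below e ⟩
    toℕ e          ∎)
    where open ≤-Reasoning

  simple : Simple ends
  simple = (λ e eq → <-irrefl (cong toℕ (sym eq)) (s≤s (par-below e))) , same-edge
    where
    same-edge : ∀ e e' u v → Joins ends e u v → Joins ends e' u v → e ≡ e'
    same-edge e e' u v (inj₁ x) (inj₁ y) = fsuc-injective (trans (cong proj₁ x) (sym (cong proj₁ y)))
    same-edge e e' u v (inj₁ x) (inj₂ y) = ⊥-elim (crossed e e' (trans (cong proj₁ x) (sym (cong proj₂ y))) (trans (cong proj₁ y) (sym (cong proj₂ x))))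
    same-edge e e' u v (inj₂ x) (inj₁ y) = ⊥-elim (crossed e e' (trans (cong proj₁ x) (sym (cong proj₂ y))) (trans (cong proj₁ y) (sym (cong proj₂ x))))
    same-edge e e' u v (inj₂ x) (inj₂ y) = fsuc-injective (trans (cong proj₁ x) (sym (cong proj₁ y)))

  ToRoot : Fin (suc M) → Set
  ToRoot u = Σ ℕPath λ w → at w 0 ≡ u × last w ≡ fzero × (∀ t → t ≤ size w → toℕ (at w t) ≤ toℕ u)

  to-root : ∀ d u → toℕ u ≤ d → ToRoot u
  to-root d fzero _ = record { size = 0 ; at = λ _ → fzero ; at-inj = λ i≤0 j≤0 _ → trans (n≤0⇒n≡0 i≤0) (sym (n≤0⇒n≡0 j≤0)) ; step = λ _ () }
                      , refl , refl , λ _ _ → z≤n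
  to-root (suc d) (fsuc e) (s≤s e≤d) with to-root d (par e) (≤-trans (par-below e) e≤d)
  ... | w , w-first , w-last , w-below = record { size = suc (size w) ; at = W ; at-inj = W-inj ; step = W-step } , refl , w-last , W-below
    where
    W : ℕ → Fin (suc M)
    W zero = fsuc e
    W (suc t) = at w t
    child-fresh : ∀ t → t ≤ size w → fsuc e ≢ at w t
    child-fresh t t≤ eq = <⇒≱ (s≤s ≤-refl) (≤-trans (≤-reflexive (cong toℕ eq)) (≤-trans (w-below t t≤) (par-below e)))
    W-inj : ∀ {i j} → i ≤ suc (size w) → j ≤ suc (size w) → W i ≡ W j → i ≡ j
    W-inj {zero} {zero} _ _ _ = refl
    W-inj {zero} {suc j} _ j≤ eq = ⊥-elim (child-fresh j (s≤s⁻¹ j≤) eq)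
    W-inj {suc i} {zero} i≤ _ eq = ⊥-elim (child-fresh i (s≤s⁻¹ i≤) (sym eq))
    W-inj {suc i} {suc j} i≤ j≤ eq = cong suc (at-inj w (s≤s⁻¹ i≤) (s≤s⁻¹ j≤) eq)
    W-step : ∀ i → i < suc (size w) → Adj (W i) (W (suc i))
    W-step zero _ = e , inj₁ (cong (fsuc e ,_) (sym w-first))
    W-step (suc i) i< = step w i (s≤s⁻¹ i<)
    W-below : ∀ t → t ≤ suc (size w) → toℕ (W t) ≤ toℕ (fsuc e)
    W-below zero _ = ≤-refl
    W-below (suc t) t≤ = ≤-trans (w-below t (s≤s⁻¹ t≤)) (≤-trans (par-below e) (n≤1+n _))

  connected : Connected ends
  connected u v = toPath joined , trans joined-first (proj₁ (proj₂ U)) , trans (toPath-end joined) (trans joined-last (proj₁ (proj₂ V)))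
    where
    U : ToRoot u
    U = to-root (toℕ u) u ≤-refl
    V : ToRoot v
    V = to-root (toℕ v) v ≤-refl
    open Join (proj₁ U) (proj₁ V) (trans (proj₁ (proj₂ (proj₂ U))) (sym (proj₁ (proj₂ (proj₂ V)))))

  -- the parent of a vertex (the root is its own parent)
  parent : Fin (suc M) → Fin (suc M)
  parent fzero = fzero
  parent (fsuc e) = par e

  lower-neighbour : ∀ {w u} → Adj w u → toℕ u < toℕ w → u ≡ parent w
  lower-neighbour (e , inj₁ x) _ = trans (sym (cong proj₂ x)) (cong parent (cong proj₁ x))
  lower-neighbour {w} {u} (e , inj₂ y) u<w = ⊥-elim (<⇒≱ u<w (begin
    toℕ w        ≡⟨ cong toℕ (cong proj₂ y) ⟨
    toℕ (par e)  ≤⟨ ≤-trans (par-below e) (n≤1+n _) ⟩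
    toℕ (fsuc e) ≡⟨ cong toℕ (cong proj₁ y) ⟩
    toℕ u        ∎))
    where open ≤-Reasoning

  -- A cycle would give its largest vertex two distinct lower neighbours.
  no-cycle : ∀ c → 2 ≤ size c → Adj (last c) (at c 0) → ⊥
  no-cycle c 2≤ closing with argmax (λ t → toℕ (at c t)) (size c)
  ... | x , x≤ , max with cycle-neighbours c 2≤ closing x x≤
  ...   | y , y' , y≢y' , y≤ , y'≤ , ay , ay' = y≢y' (at-inj c y≤ y'≤ (trans (lower y≤ ay) (sym (lower y'≤ ay'))))
    where
    lower : ∀ {z} → z ≤ size c → Adj (at c x) (at c z) → at c z ≡ parent (at c x)
    lower z≤ az = lower-neighbour az (≤∧≢⇒< (max _ z≤) λ eq → adj-distinct (proj₁ simple) az (sym (toℕ-injective eq)))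

  acyclic : Acyclic ends
  acyclic (p , 2≤ , e , closes) = no-cycle (fromPath p) 2≤ (e , subst (λ z → Joins ends e z (start p)) (sym (fromPath-end p)) closes)

  isTree : IsTree ends
  isTree = simple , connected , acyclic

-- The spider with K + 2 legs of K = k + 1 edges, centred at vertex 0.  On leg
-- a the vertex at distance d + 1 from the centre is a·K + d + 1, and the edge
-- a·K + d joins it to the vertex at distance d; so the edges form a parent
-- array in which par e is e itself, or the centre when K divides e.
module Spider (k : ℕ) where

  K : ℕ
  K = suc k

  legs : ℕ
  legs = suc (suc K)

  M : ℕ
  M = legs * K

  onLeg : ℕ → ℕ → ℕ
  onLeg zero _ = 0
  onLeg (suc _) e = e

  parentN : ℕ → ℕ
  parentN e = onLeg (e % K) e

  parentN≤ : ∀ e → parentN e ≤ e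
  parentN≤ e with e % K
  ... | zero = z≤n
  ... | suc _ = ≤-refl

  par : Fin M → Fin (suc M)
  par e = clamp M (parentN (toℕ e))

  toℕ-par : ∀ e → toℕ (par e) ≡ parentN (toℕ e)
  toℕ-par e = toℕ-clamp M _ (≤-trans (parentN≤ (toℕ e)) (<⇒≤ (toℕ<n e)))

  open ParentTree par (λ e → ≤-trans (≤-reflexive (toℕ-par e)) (parentN≤ (toℕ e)))
  open IndexedPaths ends

  digit-bound : ∀ {a d} → a < legs → d < K → a * K + d < M
  digit-bound {a} {d} a< d< = begin-strict
    a * K + d  <⟨ +-monoʳ-< (a * K) d< ⟩
    a * K + K  ≡⟨ +-comm (a * K) K ⟩
    suc a * K  ≤⟨ *-monoˡ-≤ K a< ⟩
    M          ∎
    where open ≤-Reasoning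

  digit : ∀ a {d} → d < K → (a * K + d) % K ≡ d
  digit a {d} d< = trans (cong (_% K) (+-comm (a * K) d)) (trans ([m+kn]%n≡m%n d a K) (m<n⇒m%n≡m d<))

  digits-unique : ∀ {a b d d'} → d < K → d' < K → a * K + d ≡ b * K + d' → a ≡ b × d ≡ d'
  digits-unique {a} {b} {d} {d'} d< d'< eq = *-cancelʳ-≡ a b K (+-cancelʳ-≡ d (a * K) (b * K) (trans eq (cong (b * K +_) (sym d≡d')))) , d≡d'
    where
    d≡d' : d ≡ d'
    d≡d' = trans (sym (digit a d<)) (trans (cong (_% K) eq) (digit b d'<))

  vertN : ℕ → ℕ → ℕ
  vertN a zero = 0
  vertN a (suc d) = suc (a * K + d)

  vert : Fin legs → ℕ → Fin (suc M)
  vert a d = clamp M (vertN (toℕ a) d)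

  toℕ-vert : ∀ a {d} → d ≤ K → toℕ (vert a d) ≡ vertN (toℕ a) d
  toℕ-vert a {zero} _ = refl
  toℕ-vert a {suc d} d< = toℕ-clamp M _ (digit-bound (toℕ<n a) d<)

  vertN-meet : ∀ {a b} d d' → d ≤ K → d' ≤ K → vertN a d ≡ vertN b d' → (d ≡ 0 × d' ≡ 0) ⊎ (a ≡ b × d ≡ d')
  vertN-meet zero zero _ _ _ = inj₁ (refl , refl)
  vertN-meet (suc d) (suc d') d< d'< eq with digits-unique d< d'< (suc-injective eq)
  ... | a≡b , d≡d' = inj₂ (a≡b , cong suc d≡d')

  vert-meet : ∀ {a b d d'} → d ≤ K → d' ≤ K → vert a d ≡ vert b d' → (d ≡ 0 × d' ≡ 0) ⊎ (a ≡ b × d ≡ d')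
  vert-meet {a} {b} {d} {d'} d≤ d'≤ eq with vertN-meet d d' d≤ d'≤ (trans (sym (toℕ-vert a d≤)) (trans (cong toℕ eq) (toℕ-vert b d'≤)))
  ... | inj₁ centre = inj₁ centre
  ... | inj₂ (a≡b , d≡d') = inj₂ (toℕ-injective a≡b , d≡d')

  legEdge : Fin legs → Fin K → Fin M
  legEdge a s = fromℕ< (digit-bound (toℕ<n a) (toℕ<n s))

  parentN-leg : ∀ a {d} → d < K → parentN (a * K + d) ≡ vertN a d
  parentN-leg a {d} d< = trans (cong (λ r → onLeg r (a * K + d)) (digit a d<)) (on-leg d)
    where
    on-leg : ∀ d → onLeg d (a * K + d) ≡ vertN a d
    on-leg zero = refl
    on-leg (suc d) = +-suc (a * K) d

  leg-joins : ∀ a d (d< : d < K) → Joins ends (legEdge a (fromℕ< d<)) (vert a d) (vert a (suc d))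
  leg-joins a d d< = inj₂ (cong₂ _,_ (toℕ-injective outer) (toℕ-injective inner))
    where
    open ≡-Reasoning
    edge-value : toℕ (legEdge a (fromℕ< d<)) ≡ toℕ a * K + d
    edge-value = trans (toℕ-fromℕ< _) (cong (toℕ a * K +_) (toℕ-fromℕ< d<))
    outer : suc (toℕ (legEdge a (fromℕ< d<))) ≡ toℕ (vert a (suc d))
    outer = trans (cong suc edge-value) (sym (toℕ-vert a d<))
    inner : toℕ (par (legEdge a (fromℕ< d<))) ≡ toℕ (vert a d)
    inner = begin
      toℕ (par (legEdge a (fromℕ< d<))) ≡⟨ toℕ-par (legEdge a (fromℕ< d<)) ⟩
      parentN (toℕ (legEdge a (fromℕ< d<))) ≡⟨ cong parentN edge-value ⟩
      parentN (toℕ a * K + d)           ≡⟨ parentN-leg (toℕ a) d< ⟩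
      vertN (toℕ a) d                   ≡⟨ toℕ-vert a (<⇒≤ d<) ⟨
      toℕ (vert a d)                    ∎

  leg : Fin legs → ℕPath
  leg a = record
    { size = K
    ; at = vert a
    ; at-inj = λ i≤ j≤ eq → same-leg (vert-meet i≤ j≤ eq)
    ; step = λ d d< → legEdge a (fromℕ< d<) , leg-joins a d d<
    }
    where
    same-leg : ∀ {i j} → (i ≡ 0 × j ≡ 0) ⊎ (a ≡ a × i ≡ j) → i ≡ j
    same-leg (inj₁ (i≡0 , j≡0)) = trans i≡0 (sym j≡0)
    same-leg (inj₂ (_ , i≡j)) = i≡j

  leg-edges : ∀ a {e} → EdgeOf (leg a) e → Σ[ s ∈ Fin K ] legEdge a s ≡ e
  leg-edges a (d , d< , eq) = fromℕ< d< , eq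

  module Tip (a b : Fin legs) (a≢b : a ≢ b) where

    apart : ∀ {i j} → i ≤ K → j ≤ K → vert a (K ∸ i) ≡ vert b j → i ≡ K
    apart {i} i≤ j≤ eq with vert-meet (m∸n≤m K i) j≤ eq
    ... | inj₁ (K∸i≡0 , _) = ≤-antisym i≤ (m∸n≡0⇒m≤n K∸i≡0)
    ... | inj₂ (a≡b , _) = ⊥-elim (a≢b a≡b)

    open Glue (reverse (leg a)) (leg b) (cong (vert a) (n∸n≡0 K)) apart

    tip : ℕPath
    tip = glued

    tip-edges : ∀ {e} → EdgeOf tip e → (Σ[ s ∈ Fin K ] legEdge a s ≡ e) ⊎ (Σ[ s ∈ Fin K ] legEdge b s ≡ e)
    tip-edges on-tip with glued-edges on-tip
    ... | inj₁ on-a = inj₁ (leg-edges a (reverse-edges (leg a) on-a))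
    ... | inj₂ on-b = inj₂ (leg-edges b on-b)

  open Tip using (tip; tip-edges)

  between : Fin legs → Fin legs → List (Path ends)
  between a b with a ≟F b
  ... | yes _ = []
  ... | no a≢b = toPath (tip a b a≢b) ∷ []

  tipPaths : List (Path ends)
  tipPaths = concat (tabulate λ a → concat (tabulate (between a)))

  all-between : ∀ {Q : Path ends → Set} → (∀ a b a≢b → Q (toPath (tip a b a≢b))) → ∀ a b → All Q (between a b)
  all-between q a b with a ≟F b
  ... | yes _ = []
  ... | no a≢b = q a b a≢b ∷ []

  all-tipPaths : ∀ {Q : Path ends → Set} → (∀ a b a≢b → Q (toPath (tip a b a≢b))) → All Q tipPaths
  all-tipPaths q = concat⁺ (tabulate⁺ λ a → concat⁺ (tabulate⁺ (all-between q a)))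

  from-between : ∀ {Q : Path ends → Set} a b → a ≢ b → All Q (between a b) → Σ[ a≢b ∈ a ≢ b ] Q (toPath (tip a b a≢b))
  from-between a b a≢b all with a ≟F b
  ... | yes a≡b = ⊥-elim (a≢b a≡b)
  ... | no a≢b' with all
  ...   | q ∷ [] = a≢b' , q

  from-tipPaths : ∀ {Q : Path ends → Set} → All Q tipPaths → ∀ a b → a ≢ b → Σ[ a≢b ∈ a ≢ b ] Q (toPath (tip a b a≢b))
  from-tipPaths all a b a≢b = from-between a b a≢b
    (tabulate⁻ {f = between a} (concat⁻ (tabulate⁻ {f = λ a → concat (tabulate (between a))} (concat⁻ {xss = tabulate λ a → concat (tabulate (between a))} all) a)) b)

  missing : (c : Fin M → Fin (suc K)) (a : Fin legs) → Σ[ j ∈ Fin (suc K) ] (∀ s → c (legEdge a s) ≢ j)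
  missing c a = not-onto (λ s → c (legEdge a s))

  -- Two of the K + 2 legs miss the same colour, and so does the path joining
  -- their tips, which uses only edges of those two legs.
  no-colouring : ∀ (c : Fin M → Fin (suc K)) → ¬ All (Polychromatic c) tipPaths
  no-colouring c all with pigeonhole (≤-refl {legs}) (λ a → proj₁ (missing c a))
  ... | a , b , a<b , same with from-tipPaths all a b (<⇒≢F a<b)
  ...   | a≢b , poly with poly (proj₁ (missing c a))
  ...     | i , coloured with tip-edges a b a≢b (toPath-edges (tip a b a≢b) i)
  ...       | inj₁ (s , eq) = proj₂ (missing c a) s (trans (cong c eq) coloured)
  ...       | inj₂ (s , eq) = proj₂ (missing c b) s (trans (cong c eq) (trans coloured same))

  family : ∀ {r} → r ≤ K + K → ∃ λ (n : ℕ) → ∃ λ (m : ℕ) → Σ (Ends (suc n) m) λ ends → IsTree ends ×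
    Σ (List (Path ends)) λ P → All (λ p → r ≤ len p) P × (∀ (c : Fin m → Fin (suc K)) → ¬ All (Polychromatic c) P)
  family r≤2K = M , M , ends , isTree , tipPaths , all-tipPaths (λ _ _ _ → r≤2K) , no-colouring

-- For r = k' + 1 put K = ⌈ r /2⌉ = ⌊ k' /2⌋ + 1; then 2K - 1 ≤ r ≤ 2K.
theorem5 : ∀ (r : ℕ) → 1 ≤ r →
    (∀ (n m : ℕ) (ends : Ends (suc n) m) → IsTree ends →
      (P : List (Path ends)) → All (λ p → r ≤ len p) P →
      ∃ λ (c : Fin m → Fin ⌈ r /2⌉) → All (Polychromatic c) P)
    ×
    (∃ λ (n : ℕ) → ∃ λ (m : ℕ) → Σ (Ends (suc n) m) λ ends → IsTree ends ×
      Σ (List (Path ends)) λ P → All (λ p → r ≤ len p) P ×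
      (∀ (c : Fin m → Fin (suc ⌈ r /2⌉)) → ¬ All (Polychromatic c) P))
theorem5 (suc k') _ = (λ n m ends tree → colouring k ends tree lower) , Spider.family k upper
  where
  k : ℕ
  k = ⌊ k' /2⌋
  lower : suc (k + k) ≤ suc k'
  lower = s≤s (≤-trans (+-monoʳ-≤ k (⌊n/2⌋≤⌈n/2⌉ k')) (≤-reflexive (⌊n/2⌋+⌈n/2⌉≡n k')))
  upper : suc k' ≤ suc k + suc k
  upper = ≤-trans (≤-reflexive (sym (⌊n/2⌋+⌈n/2⌉≡n (suc k')))) (+-monoˡ-≤ (suc k) (⌊n/2⌋≤⌈n/2⌉ (suc k')))
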